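{- Fix a positive integer $p$. Let $\lambda=[a_0,a_1,\ldots]_p$ and $\mu=[b_0,b_1,\ldots]_p$ be integral partitions all of whose entries are powers of $p$, where $a_k$ (resp. $b_k$) is the number of entries of $\lambda$ (resp. $\mu$) equal to $p^k$. Fix an index $i$ and let $\tilde\lambda$, $\tilde\mu$ be obtained from $\lambda,\mu$ by replacing $a_i$ with $a_i-\min\{a_i,b_i\}$ and $b_i$ with $b_i-\min\{a_i,b_i\}$ (all other counts unchanged). Then $\lambda$ stably embeds into $\mu$ if and only if $\tilde\lambda$ stably embeds into $\tilde\mu$.
   Context: An integral partition is a finite nonincreasing sequence of positive integers. The product $\lambda\times\nu$ of partitions is the partition whose entries are all products of an entry of $\lambda$ with an entry of $\nu$, reordered nonincreasingly. For $\alpha=[\alpha_1,\ldots,\alpha_m]$, $\beta=[\beta_1,\ldots,\beta_n]$ we write $\alpha\hookrightarrow\beta$ if there is a map $\varphi:\{1,\ldots,m\}\to\{1,\ldots,n\}$ with $\sum_{i\in\varphi^{ -1}(j)}\alpha_i\le\beta_j$ for all $j$. $\lambda$ stably embeds into $\mu$ if there is some partition $\nu$ with $\lambda\times\nu\hookrightarrow\mu\times\nu$. -}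

module Defs where

open import Data.Nat using (ℕ; zero; suc; _+_; _*_; _∸_; _^_; _≤_; _≥_; _<_; _⊓_)
open import Data.Nat.Properties using (≤-decTotalOrder)
open import Data.Nat.ListAction using (sum)
open import Data.List using (List; []; _∷_; length; map; concatMap; reverse; replicate; concat; lookup; allFin; _++_)
open import Data.List.Relation.Unary.All using (All)
open import Data.List.Relation.Unary.Linked using (Linked)
open import Data.List.Relation.Unary.Any using (Any)
open import Data.Fin using (Fin; _≟_)
open import Data.Product using (Σ; ∃; _×_)
open import Relation.Nullary using (does)
open import Data.Bool using (if_then_else_)
import Data.List.Sort

record Partition : Set where
  constructor mkPartition
  field
    entries     : List ℕ
    positive    : All (λ x → 0 < x) entries
    nonincreasing : Linked _≥_ entries
open Partition public

sortDesc : List ℕ → List ℕ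
sortDesc xs = reverse (Data.List.Sort.sort ≤-decTotalOrder xs)

_⊠_ : List ℕ → List ℕ → List ℕ
λs ⊠ νs = sortDesc (concatMap (λ x → map (x *_) νs) λs)

fiberSum : (α : List ℕ) {n : ℕ} → (Fin (length α) → Fin n) → Fin n → ℕ
fiberSum α φ j = sum (map (λ i → if does (φ i ≟ j) then lookup α i else 0) (allFin (length α)))

_↪_ : List ℕ → List ℕ → Set
α ↪ β = Σ (Fin (length α) → Fin (length β)) λ φ →
          (j : Fin (length β)) → fiberSum α φ j ≤ lookup β j

StablyEmbeds : Partition → Partition → Set
StablyEmbeds λp μp = Σ Partition λ ν →
  (0 < length (entries ν)) × ((entries λp ⊠ entries ν) ↪ (entries μp ⊠ entries ν))

-- Count lists: the partition [a₀,a₁,…]_p has aₖ entries equal to p^k.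
-- A count list a : List ℕ gives aₖ = a !! k, and 0 beyond its length.
countAt : List ℕ → ℕ → ℕ
countAt []       _       = 0
countAt (x ∷ _)  zero    = x
countAt (_ ∷ xs) (suc k) = countAt xs k

-- Replace the k-th count by f applied to it (no change beyond the length,
-- where the count is 0 and only the case f 0 = 0 is ever used).
modifyAt : ℕ → (ℕ → ℕ) → List ℕ → List ℕ
modifyAt _       _ []       = []
modifyAt zero    f (x ∷ xs) = f x ∷ xs
modifyAt (suc k) f (x ∷ xs) = x ∷ modifyAt k f xs

powEntries : ℕ → ℕ → List ℕ → List ℕ
powEntries p k []       = []
powEntries p k (a ∷ as) = replicate a (p ^ k) ++ powEntries p (suc k) as

powList : ℕ → List ℕ → List ℕ
powList p a = sortDesc (powEntries p 0 a)

-- For lists of powers of p, with α sorted nonincreasingly, α ↪ β holds iff for every k the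
-- entries of α that are ≥ p ^ k sum to at most the corresponding sum for β. Necessity holds for
-- any embedding, since discarding the entries below a threshold is superadditive. Sufficiency is
-- a greedy argument: place the entries of α largest first, measuring the capacity of each part of
-- β rounded down to a multiple of p ^ k.
--
-- The test partition ν of a stable embedding can be replaced by one made of powers of p: every
-- entry n is rounded down to the largest power p ^ m ≤ n and repeated n · p ^ (M - m) times.
-- This multiplies all thresholded sums of λ × ν and μ × ν by p ^ M, so λ stably embeds into μ iff
-- the threshold inequalities hold for λ × ν and μ × ν for some ν. The thresholded sum of λ × ν is
-- additive in the entries of λ, so entries p ^ i common to λ and μ contribute equally to both sides
-- and cancel.
module Submission where

open import Data.Bool using (true; false; if_then_else_)
open import Data.Fin using (Fin; _≟_) renaming (zero to fzero; suc to fsuc)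
open import Data.List using (List; []; _∷_; length; map; concatMap; replicate; lookup; tabulate; reverseAcc; _++_)
open import Data.List.Properties using (++-assoc; tabulate-lookup; length-replicate; length-++-≤ˡ; map-++; map-cong; map-cong-local; map-∘)
open import Data.List.Relation.Binary.Permutation.Propositional using (_↭_; ↭-refl; ↭-sym; ↭-trans; module PermutationReasoning)
open import Data.List.Relation.Binary.Permutation.Propositional.Properties using (map⁺; ++⁺ˡ; ++⁺ʳ; ++-comm; ↭-reverse; ↭-length; All-resp-↭)
open import Data.List.Relation.Unary.All using (All; []; _∷_)
import Data.List.Relation.Unary.All as All
open import Data.List.Relation.Unary.All.Properties using (++⁺; concat⁺; replicate⁺) renaming (map⁺ to map⁺ᴬ)
open import Data.List.Relation.Unary.AllPairs using (AllPairs; []; _∷_)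
open import Data.List.Relation.Unary.Linked using (Linked; []; [-]; _∷_)
open import Data.List.Relation.Unary.Linked.Properties using (Linked⇒AllPairs)
open import Data.Nat using (ℕ; zero; suc; _+_; _*_; _∸_; _^_; _≤_; _≥_; _<_; _⊓_; z≤n; s≤s; z<s; _≤?_; _<?_; NonZero; >-nonZero; >-nonZero⁻¹)
open import Data.Nat.Divisibility using (_∣_; divides; divides-refl; ∣-reflexive)
open import Data.Nat.DivMod using (_/_; [m∸n*o]/o≡m/o∸n; m*n/n≡m; /-monoˡ-≤; m/n*n≡m; m<n⇒m/n≡0)
open import Data.Nat.ListAction using (sum)
open import Data.Nat.ListAction.Properties using (sum-++; sum-↭)
open import Data.Nat.Properties hiding (_≟_)
open import Data.Nat.Tactic.RingSolver using (solve-∀)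
open import Algebra.Properties.CommutativeMonoid.Sum +-0-commutativeMonoid
  using (sum-syntax; ∑-comm; ∑-distrib-+; sum-cong-≗; sum-replicate-zero)
  renaming (sum to ∑)
open import Data.List.Sort ≤-decTotalOrder using (sort; sort-↭; sort-↗)
open import Data.Product using (Σ; ∃; _,_; proj₁; proj₂)
open import Data.Sum using (inj₁; inj₂)
open import Function using (_∘_; id; flip)
open import Function.Bundles using (_⇔_; mk⇔)
open import Function.Properties.Equivalence using (⇔-setoid)
open import Level using (0ℓ)
open import Relation.Binary.PropositionalEquality
import Relation.Binary.Reasoning.Setoid as SetoidReasoning
open import Relation.Nullary using (does; yes; no; contradiction)
open import Relation.Nullary.Decidable using (dec-true; dec-false)

open import Defs

∑-mono-≤ : ∀ {n} {f g : Fin n → ℕ} → (∀ i → f i ≤ g i) → ∑ f ≤ ∑ g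
∑-mono-≤ {zero}  f≤g = z≤n
∑-mono-≤ {suc n} f≤g = +-mono-≤ (f≤g fzero) (∑-mono-≤ (f≤g ∘ fsuc))

∑-indicator : ∀ {n} (k : Fin n) v → ∑[ j < n ] (if does (k ≟ j) then v else 0) ≡ v
∑-indicator {suc n} fzero v = trans (cong (v +_) (sum-replicate-zero n)) (+-identityʳ v)
∑-indicator {suc n} (fsuc k) v = ∑-indicator k v

∑-positive : ∀ {n} (f : Fin n → ℕ) → 0 < ∑ f → ∃ λ i → 0 < f i
∑-positive {suc n} f ∑f>0 with f fzero in eq
... | suc _ = fzero , subst (0 <_) (sym eq) (s≤s z≤n)
... | zero  = let i , fi>0 = ∑-positive (f ∘ fsuc) ∑f>0 in fsuc i , fi>0

sum-map-tabulate : ∀ {A : Set} {n} (g : A → ℕ) (f : Fin n → A) → sum (map g (tabulate f)) ≡ ∑ (g ∘ f)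
sum-map-tabulate {n = zero}  g f = refl
sum-map-tabulate {n = suc n} g f = cong (g (f fzero) +_) (sum-map-tabulate g (f ∘ fsuc))

fiber : ∀ {m n} → (Fin m → Fin n) → (Fin m → ℕ) → Fin n → ℕ
fiber {m} φ f j = ∑[ i < m ] (if does (φ i ≟ j) then f i else 0)

fiberSum≡fiber : ∀ α {n} (φ : Fin (length α) → Fin n) j → fiberSum α φ j ≡ fiber φ (lookup α) j
fiberSum≡fiber α φ j = sum-map-tabulate (λ i → if does (φ i ≟ j) then lookup α i else 0) id

∑-fiber : ∀ {m n} (φ : Fin m → Fin n) f → ∑[ j < n ] fiber φ f j ≡ ∑ f
∑-fiber {m} {n} φ f = begin
  ∑[ j < n ] ∑[ i < m ] (if does (φ i ≟ j) then f i else 0) ≡⟨ ∑-comm (λ i j → if does (φ i ≟ j) then f i else 0) ⟨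
  ∑[ i < m ] ∑[ j < n ] (if does (φ i ≟ j) then f i else 0) ≡⟨ sum-cong-≗ (λ i → ∑-indicator (φ i) (f i)) ⟩
  ∑ f                                                        ∎
  where open ≡-Reasoning

sum-map-lookup : ∀ (g : ℕ → ℕ) xs → sum (map g xs) ≡ ∑ (g ∘ lookup xs)
sum-map-lookup g xs = trans (cong (sum ∘ map g) (sym (tabulate-lookup xs))) (sum-map-tabulate g (lookup xs))

sum-map-++ : ∀ {A : Set} (f : A → ℕ) xs ys → sum (map f (xs ++ ys)) ≡ sum (map f xs) + sum (map f ys)
sum-map-++ f xs ys = trans (cong sum (map-++ f xs ys)) (sum-++ (map f xs) (map f ys))

sum-map-↭ : ∀ {A : Set} (f : A → ℕ) {xs ys} → xs ↭ ys → sum (map f xs) ≡ sum (map f ys)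
sum-map-↭ f xs↭ys = sum-↭ (map⁺ f xs↭ys)

sum-map-concatMap : ∀ {A B : Set} (f : B → ℕ) (h : A → List B) xs →
                    sum (map f (concatMap h xs)) ≡ sum (map (λ x → sum (map f (h x))) xs)
sum-map-concatMap f h []       = refl
sum-map-concatMap f h (x ∷ xs) =
  trans (sum-map-++ f (h x) (concatMap h xs)) (cong (sum (map f (h x)) +_) (sum-map-concatMap f h xs))

sum-map-replicate : ∀ {A : Set} (f : A → ℕ) c y → sum (map f (replicate c y)) ≡ c * f y
sum-map-replicate f zero    y = refl
sum-map-replicate f (suc c) y = cong (f y +_) (sum-map-replicate f c y)

sum-map-*ˡ : ∀ {A : Set} c (f : A → ℕ) xs → sum (map (λ x → c * f x) xs) ≡ c * sum (map f xs)
sum-map-*ˡ c f []       = sym (*-zeroʳ c)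
sum-map-*ˡ c f (x ∷ xs) = trans (cong (c * f x +_) (sum-map-*ˡ c f xs)) (sym (*-distribˡ-+ c (f x) _))

≤-sum-map : ∀ {A : Set} (f : A → ℕ) xs → All (λ x → f x ≤ sum (map f xs)) xs
≤-sum-map f []       = []
≤-sum-map f (x ∷ xs) = m≤m+n (f x) _ ∷ All.map (λ y≤ → ≤-trans y≤ (m≤n+m _ (f x))) (≤-sum-map f xs)

-- Thresholded sums

above : ℕ → ℕ → ℕ
above t x = if does (t ≤? x) then x else 0

sumAbove : ℕ → List ℕ → ℕ
sumAbove t xs = sum (map (above t) xs)

above-≥ : ∀ {t x} → t ≤ x → above t x ≡ x
above-≥ {t} {x} t≤x = cong (λ b → if b then x else 0) (dec-true (t ≤? x) t≤x)

above-< : ∀ {t x} → x < t → above t x ≡ 0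
above-< {t} {x} x<t = cong (λ b → if b then x else 0) (dec-false (t ≤? x) (<⇒≱ x<t))

above-≤ : ∀ t x → above t x ≤ x
above-≤ t x with t ≤? x
... | yes t≤x = ≤-reflexive (above-≥ t≤x)
... | no  t≰x = subst (_≤ x) (sym (above-< (≰⇒> t≰x))) z≤n

above-mono-≤ : ∀ t {x y} → x ≤ y → above t x ≤ above t y
above-mono-≤ t {x} {y} x≤y with t ≤? x
... | yes t≤x = ≤-trans (above-≤ t x) (≤-trans x≤y (≤-reflexive (sym (above-≥ (≤-trans t≤x x≤y)))))
... | no  t≰x = subst (_≤ above t y) (sym (above-< (≰⇒> t≰x))) z≤n

above-superadditive : ∀ t x y → above t x + above t y ≤ above t (x + y)
above-superadditive t x y with t ≤? x + y
... | yes t≤x+y = ≤-trans (+-mono-≤ (above-≤ t x) (above-≤ t y)) (≤-reflexive (sym (above-≥ t≤x+y)))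
... | no  t≰x+y = ≤-reflexive (begin
  above t x + above t y ≡⟨ cong₂ _+_ (above-< (≤-<-trans (m≤m+n x y) x+y<t)) (above-< (≤-<-trans (m≤n+m y x) x+y<t)) ⟩
  0                     ≡⟨ above-< x+y<t ⟨
  above t (x + y)       ∎)
  where open ≡-Reasoning
        x+y<t = ≰⇒> t≰x+y

sumAbove-< : ∀ {t} xs → All (_< t) xs → sumAbove t xs ≡ 0
sumAbove-< []       []            = refl
sumAbove-< (x ∷ xs) (x<t ∷ xs<t) = cong₂ _+_ (above-< x<t) (sumAbove-< xs xs<t)

fiber-above : ∀ {m n} (φ : Fin m → Fin n) f t j → fiber φ (above t ∘ f) j ≤ above t (fiber φ f j)
fiber-above {zero}  φ f t j = z≤n
fiber-above {suc m} φ f t j with does (φ fzero ≟ j)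
... | true  = ≤-trans (+-monoʳ-≤ (above t (f fzero)) (fiber-above (φ ∘ fsuc) (f ∘ fsuc) t j))
                      (above-superadditive t (f fzero) (fiber (φ ∘ fsuc) (f ∘ fsuc) j))
... | false = fiber-above (φ ∘ fsuc) (f ∘ fsuc) t j

↪⇒sumAbove-≤ : ∀ α β → α ↪ β → ∀ t → sumAbove t α ≤ sumAbove t β
↪⇒sumAbove-≤ α β (φ , φ-fits) t = begin
  sumAbove t α                                   ≡⟨ sum-map-lookup (above t) α ⟩
  ∑ (above t ∘ lookup α)                         ≡⟨ ∑-fiber φ (above t ∘ lookup α) ⟨
  ∑[ j < length β ] fiber φ (above t ∘ lookup α) j ≤⟨ ∑-mono-≤ (λ j → fiber-above φ (lookup α) t j) ⟩
  ∑[ j < length β ] above t (fiber φ (lookup α) j) ≤⟨ ∑-mono-≤ (λ j → above-mono-≤ t (fits j)) ⟩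
  ∑ (above t ∘ lookup β)                         ≡⟨ sum-map-lookup (above t) β ⟨
  sumAbove t β                                   ∎
  where
  open ≤-Reasoning
  fits : ∀ j → fiber φ (lookup α) j ≤ lookup β j
  fits j = subst (_≤ lookup β j) (fiberSum≡fiber α φ j) (φ-fits j)

sortDesc-↭ : ∀ xs → sortDesc xs ↭ xs
sortDesc-↭ xs = ↭-trans (↭-reverse (sort xs)) (sort-↭ xs)

reverseAcc-nonincreasing : ∀ {x} xs acc → Linked _≤_ (x ∷ xs) → Linked _≥_ (x ∷ acc) →
                           Linked _≥_ (reverseAcc (x ∷ acc) xs)
reverseAcc-nonincreasing []       acc _           x∷acc↘ = x∷acc↘
reverseAcc-nonincreasing (y ∷ ys) acc (x≤y ∷ y∷ys↗) x∷acc↘ =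
  reverseAcc-nonincreasing ys _ y∷ys↗ (x≤y ∷ x∷acc↘)

sortDesc-nonincreasing : ∀ xs → Linked _≥_ (sortDesc xs)
sortDesc-nonincreasing xs with sort xs | sort-↗ xs
... | []     | _  = []
... | y ∷ ys | ↗ = reverseAcc-nonincreasing ys [] ↗ [-]

sumAbove-⊠ : ∀ t X ν → sumAbove t (X ⊠ ν) ≡ sum (map (λ x → sum (map (λ n → above t (x * n)) ν)) X)
sumAbove-⊠ t X ν = begin
  sum (map (above t) (X ⊠ ν))                                     ≡⟨ sum-map-↭ (above t) (sortDesc-↭ _) ⟩
  sum (map (above t) (concatMap (λ x → map (x *_) ν) X))          ≡⟨ sum-map-concatMap (above t) (λ x → map (x *_) ν) X ⟩
  sum (map (λ x → sum (map (above t) (map (x *_) ν))) X)          ≡⟨ cong sum (map-cong (λ x → cong sum (map-∘ ν)) X) ⟨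
  sum (map (λ x → sum (map (λ n → above t (x * n)) ν)) X)         ∎
  where open ≡-Reasoning

sumAbove-⊠-split : ∀ t {X} X′ Z ν → X ↭ X′ ++ Z → sumAbove t (X ⊠ ν) ≡ sumAbove t (X′ ⊠ ν) + sumAbove t (Z ⊠ ν)
sumAbove-⊠-split t {X} X′ Z ν X↭X′++Z = begin
  sumAbove t (X ⊠ ν)                              ≡⟨ sumAbove-⊠ t X ν ⟩
  sum (map F X)                                   ≡⟨ sum-map-↭ F X↭X′++Z ⟩
  sum (map F (X′ ++ Z))                           ≡⟨ sum-map-++ F X′ Z ⟩
  sum (map F X′) + sum (map F Z)                  ≡⟨ cong₂ _+_ (sumAbove-⊠ t X′ ν) (sumAbove-⊠ t Z ν) ⟨
  sumAbove t (X′ ⊠ ν) + sumAbove t (Z ⊠ ν)        ∎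
  where
  open ≡-Reasoning
  F = λ x → sum (map (λ n → above t (x * n)) ν)

n<m^n : ∀ {m} → 1 < m → ∀ n → n < m ^ n
n<m^n 1<m zero    = s≤s z≤n
n<m^n {m} 1<m (suc n) = begin-strict
  suc n       ≤⟨ n<m^n 1<m n ⟩
  m ^ n       <⟨ m<m*n (m ^ n) m ⦃ m^n≢0 m n ⦄ 1<m ⟩
  m ^ n * m   ≡⟨ *-comm (m ^ n) m ⟩
  m ^ suc n   ∎
  where
  open ≤-Reasoning
  instance _ = >-nonZero (<-trans z<s 1<m)

roundDown : (q : ℕ) .{{_ : NonZero q}} → ℕ → ℕ
roundDown q y = y / q * q

module _ (q : ℕ) .{{_ : NonZero q}} where

  roundDown-∸ : ∀ {d y} → q ∣ d → d ≤ y → roundDown q (y ∸ d) + d ≡ roundDown q y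
  roundDown-∸ {y = y} (divides-refl m) m*q≤y = begin
    (y ∸ m * q) / q * q + m * q ≡⟨ cong (λ z → z * q + m * q) ([m∸n*o]/o≡m/o∸n y m q) ⟩
    (y / q ∸ m) * q + m * q     ≡⟨ *-distribʳ-+ q (y / q ∸ m) m ⟨
    (y / q ∸ m + m) * q         ≡⟨ cong (_* q) (m∸n+n≡m m≤y/q) ⟩
    y / q * q                   ∎
    where
    open ≡-Reasoning
    m≤y/q : m ≤ y / q
    m≤y/q = subst (_≤ y / q) (m*n/n≡m m q) (/-monoˡ-≤ q m*q≤y)

  roundDown-positive : ∀ y → 0 < roundDown q y → q ≤ y
  roundDown-positive y roundDown>0 with q ≤? y
  ... | yes q≤y = q≤y
  ... | no  q≰y = contradiction (cong (_* q) (m<n⇒m/n≡0 (≰⇒> q≰y))) (>⇒≢ roundDown>0)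

-- Count lists

replicate-+ : ∀ {A : Set} m n (x : A) → replicate (m + n) x ≡ replicate m x ++ replicate n x
replicate-+ zero    n x = refl
replicate-+ (suc m) n x = cong (x ∷_) (replicate-+ m n x)

powEntries-split : ∀ p k i a {c} → c ≤ countAt a i →
                   powEntries p k a ↭ powEntries p k (modifyAt i (_∸ c) a) ++ replicate c (p ^ (i + k))
powEntries-split p k i       []      z≤n = ↭-refl
powEntries-split p k zero    (x ∷ a) {c} c≤x = begin
  replicate x (p ^ k) ++ R                     ≡⟨ cong (λ n → replicate n (p ^ k) ++ R) (m∸n+n≡m c≤x) ⟨
  replicate (x ∸ c + c) (p ^ k) ++ R           ≡⟨ cong (_++ R) (replicate-+ (x ∸ c) c (p ^ k)) ⟩
  (replicate (x ∸ c) (p ^ k) ++ C) ++ R        ≡⟨ ++-assoc (replicate (x ∸ c) (p ^ k)) C R ⟩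
  replicate (x ∸ c) (p ^ k) ++ (C ++ R)        ↭⟨ ++⁺ˡ (replicate (x ∸ c) (p ^ k)) (++-comm C R) ⟩
  replicate (x ∸ c) (p ^ k) ++ (R ++ C)        ≡⟨ ++-assoc (replicate (x ∸ c) (p ^ k)) R C ⟨
  (replicate (x ∸ c) (p ^ k) ++ R) ++ C        ∎
  where
  open PermutationReasoning
  C = replicate c (p ^ k)
  R = powEntries p (suc k) a
powEntries-split p k (suc i) (x ∷ a) {c} c≤aᵢ = begin
  replicate x (p ^ k) ++ powEntries p (suc k) a                         ↭⟨ ++⁺ˡ (replicate x (p ^ k)) (powEntries-split p (suc k) i a c≤aᵢ) ⟩
  replicate x (p ^ k) ++ (R′ ++ replicate c (p ^ (i + suc k)))          ≡⟨ ++-assoc (replicate x (p ^ k)) R′ _ ⟨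
  (replicate x (p ^ k) ++ R′) ++ replicate c (p ^ (i + suc k))          ≡⟨ cong (λ e → (replicate x (p ^ k) ++ R′) ++ replicate c (p ^ e)) (+-suc i k) ⟩
  (replicate x (p ^ k) ++ R′) ++ replicate c (p ^ suc (i + k))          ∎
  where
  open PermutationReasoning
  R′ = powEntries p (suc k) (modifyAt i (_∸ c) a)

powList-split : ∀ p i a {c} → c ≤ countAt a i → powList p a ↭ powList p (modifyAt i (_∸ c) a) ++ replicate c (p ^ i)
powList-split p i a {c} c≤aᵢ = begin
  sortDesc (powEntries p 0 a)                                          ↭⟨ sortDesc-↭ _ ⟩
  powEntries p 0 a                                                     ↭⟨ powEntries-split p 0 i a c≤aᵢ ⟩
  powEntries p 0 (modifyAt i (_∸ c) a) ++ replicate c (p ^ (i + 0))    ≡⟨ cong (λ e → powEntries p 0 (modifyAt i (_∸ c) a) ++ replicate c (p ^ e)) (+-identityʳ i) ⟩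
  powEntries p 0 (modifyAt i (_∸ c) a) ++ replicate c (p ^ i)          ↭⟨ ++⁺ʳ _ (sortDesc-↭ _) ⟨
  sortDesc (powEntries p 0 (modifyAt i (_∸ c) a)) ++ replicate c (p ^ i) ∎
  where open PermutationReasoning

module PowersOf (p : ℕ) .{{_ : NonZero p}} where

  IsPower : ℕ → Set
  IsPower x = ∃ λ e → x ≡ p ^ e

  ^≤^⇒^∣^ : ∀ k e → p ^ k ≤ p ^ e → p ^ k ∣ p ^ e
  ^≤^⇒^∣^ k e pᵏ≤pᵉ with k ≤? e
  ... | yes k≤e = divides (p ^ (e ∸ k)) (trans (cong (p ^_) (sym (m∸n+n≡m k≤e))) (^-distribˡ-+-* p (e ∸ k) k))
  ... | no  k≰e = ∣-reflexive (≤-antisym pᵏ≤pᵉ (^-monoʳ-≤ p (<⇒≤ (≰⇒> k≰e))))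

  roundDownᵏ : ℕ → ℕ → ℕ
  roundDownᵏ k = roundDown (p ^ k) ⦃ m^n≢0 p k ⦄

  roundDownᵏ-power : ∀ k {y} → IsPower y → roundDownᵏ k y ≡ above (p ^ k) y
  roundDownᵏ-power k (e , refl) with p ^ k ≤? p ^ e
  ... | yes pᵏ≤pᵉ = trans (m/n*n≡m ⦃ m^n≢0 p k ⦄ (^≤^⇒^∣^ k e pᵏ≤pᵉ)) (sym (above-≥ pᵏ≤pᵉ))
  ... | no  pᵏ≰pᵉ = trans (cong (_* p ^ k) (m<n⇒m/n≡0 ⦃ m^n≢0 p k ⦄ (≰⇒> pᵏ≰pᵉ))) (sym (above-< (≰⇒> pᵏ≰pᵉ)))

  -- Greedy embedding of powers of p

  capacity : ∀ {n} → ℕ → (Fin n → ℕ) → ℕ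
  capacity k B = ∑ (roundDownᵏ k ∘ B)

  withdraw : ∀ {n} → Fin n → ℕ → (Fin n → ℕ) → Fin n → ℕ
  withdraw j x B j′ = B j′ ∸ (if does (j ≟ j′) then x else 0)

  withdraw-≡ : ∀ {n} j x (B : Fin n → ℕ) → withdraw j x B j ≡ B j ∸ x
  withdraw-≡ j x B = cong (λ b → B j ∸ (if b then x else 0)) (dec-true (j ≟ j) refl)

  withdraw-≢ : ∀ {n} {j j′} x (B : Fin n → ℕ) → j ≢ j′ → withdraw j x B j′ ≡ B j′
  withdraw-≢ {j = j} {j′} x B j≢j′ = cong (λ b → B j′ ∸ (if b then x else 0)) (dec-false (j ≟ j′) j≢j′)

  capacity-withdraw : ∀ {n} k {x} (B : Fin n → ℕ) j → p ^ k ∣ x → x ≤ B j →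
                      capacity k (withdraw j x B) + x ≡ capacity k B
  capacity-withdraw k {x} B j pᵏ∣x x≤Bj = begin
    capacity k B′ + x                         ≡⟨ cong (capacity k B′ +_) (∑-indicator j x) ⟨
    capacity k B′ + ∑ D                       ≡⟨ ∑-distrib-+ (roundDownᵏ k ∘ B′) D ⟨
    ∑ (λ j′ → roundDownᵏ k (B′ j′) + D j′) ≡⟨ sum-cong-≗ restore ⟩
    capacity k B                              ∎
    where
    open ≡-Reasoning
    B′ = withdraw j x B
    D = λ j′ → if does (j ≟ j′) then x else 0
    restore : ∀ j′ → roundDownᵏ k (B′ j′) + D j′ ≡ roundDownᵏ k (B j′)
    restore j′ with j ≟ j′
    ... | yes refl = roundDown-∸ (p ^ k) ⦃ m^n≢0 p k ⦄ pᵏ∣x x≤Bj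
    ... | no  _    = +-identityʳ _

  fitting-bin : ∀ {n} e (B : Fin n → ℕ) → p ^ e ≤ capacity e B → ∃ λ j → p ^ e ≤ B j
  fitting-bin e B pᵉ≤cap =
    let j , roundDown>0 = ∑-positive (roundDownᵏ e ∘ B) (<-≤-trans (m^n>0 p e) pᵉ≤cap)
    in  j , roundDown-positive (p ^ e) ⦃ m^n≢0 p e ⦄ (B j) roundDown>0

  Fits : (X : List ℕ) {n : ℕ} → (Fin n → ℕ) → Set
  Fits X {n} B = Σ (Fin (length X) → Fin n) λ φ → ∀ j → fiber φ (lookup X) j ≤ B j

  -- Largest piece first: once x is placed, every threshold p ^ k ≤ x loses exactly x on
  -- both sides (p ^ k divides x), while thresholds above x see nothing of the rest.
  greedy-fits : ∀ X → AllPairs _≥_ X → All IsPower X → ∀ {n} (B : Fin n → ℕ) →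
                (∀ k → sumAbove (p ^ k) X ≤ capacity k B) → Fits X B
  greedy-fits []      _          _                     B _   = (λ ()) , λ _ → z≤n
  greedy-fits (x ∷ X) (x≥X ∷ X↘) ((e , refl) ∷ X-powers) {n} B X≤B = φ , φ-fits
    where
    x≤capacity : x ≤ capacity e B
    x≤capacity = ≤-trans (subst (_≤ sumAbove x (x ∷ X)) (above-≥ ≤-refl) (m≤m+n _ _)) (X≤B e)
    bin : ∃ λ j → x ≤ B j
    bin = fitting-bin e B x≤capacity
    j = proj₁ bin
    x≤Bj = proj₂ bin
    B′ = withdraw j x B

    remaining : ∀ k → sumAbove (p ^ k) X ≤ capacity k B′
    remaining k with p ^ k ≤? x
    ... | yes pᵏ≤x = +-cancelˡ-≤ x _ _ (begin
      x + sumAbove (p ^ k) X   ≡⟨ cong (_+ sumAbove (p ^ k) X) (above-≥ pᵏ≤x) ⟨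
      sumAbove (p ^ k) (x ∷ X) ≤⟨ X≤B k ⟩
      capacity k B             ≡⟨ capacity-withdraw k B j (^≤^⇒^∣^ k e pᵏ≤x) x≤Bj ⟨
      capacity k B′ + x        ≡⟨ +-comm _ x ⟩
      x + capacity k B′        ∎)
      where open ≤-Reasoning
    ... | no  pᵏ≰x = subst (_≤ capacity k B′) (sym (sumAbove-< X X<pᵏ)) z≤n
      where X<pᵏ = All.map (λ y≤x → ≤-<-trans y≤x (≰⇒> pᵏ≰x)) x≥X

    rest : Fits X B′
    rest = greedy-fits X X↘ X-powers B′ remaining

    φ : Fin (length (x ∷ X)) → Fin n
    φ fzero    = j
    φ (fsuc i) = proj₁ rest i

    φ-fits : ∀ j′ → fiber φ (lookup (x ∷ X)) j′ ≤ B j′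
    φ-fits j′ with j ≟ j′
    ... | yes refl = begin
      x + fiber (proj₁ rest) (lookup X) j ≤⟨ +-monoʳ-≤ x (proj₂ rest j) ⟩
      x + B′ j                            ≡⟨ cong (x +_) (withdraw-≡ j x B) ⟩
      x + (B j ∸ x)                       ≡⟨ m+[n∸m]≡n x≤Bj ⟩
      B j                                 ∎
      where open ≤-Reasoning
    ... | no  j≢j′ = subst (fiber (proj₁ rest) (lookup X) j′ ≤_) (withdraw-≢ x B j≢j′) (proj₂ rest j′)

  capacity-lookup : ∀ k Y → All IsPower Y → capacity k (lookup Y) ≡ sumAbove (p ^ k) Y
  capacity-lookup k Y Y-powers = begin
    ∑ (roundDownᵏ k ∘ lookup Y)   ≡⟨ sum-map-lookup (roundDownᵏ k) Y ⟨
    sum (map (roundDownᵏ k) Y)    ≡⟨ cong sum (map-cong-local (All.map (roundDownᵏ-power k) Y-powers)) ⟩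
    sum (map (above (p ^ k)) Y)   ∎
    where open ≡-Reasoning

  sumAbove-≤⇒↪ : ∀ {X Y} → AllPairs _≥_ X → All IsPower X → All IsPower Y →
                 (∀ k → sumAbove (p ^ k) X ≤ sumAbove (p ^ k) Y) → X ↪ Y
  sumAbove-≤⇒↪ {X} {Y} X↘ X-powers Y-powers X≤Y =
    φ , λ j → subst (_≤ lookup Y j) (sym (fiberSum≡fiber X φ j)) (φ-fits j)
    where
    fits = greedy-fits X X↘ X-powers (lookup Y)
             (λ k → subst (sumAbove (p ^ k) X ≤_) (sym (capacity-lookup k Y Y-powers)) (X≤Y k))
    φ = proj₁ fits
    φ-fits = proj₂ fits

  IsPower-* : ∀ {x y} → IsPower x → IsPower y → IsPower (x * y)
  IsPower-* (d , refl) (e , refl) = d + e , sym (^-distribˡ-+-* p d e)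

  sortDesc-powers : ∀ {xs} → All IsPower xs → All IsPower (sortDesc xs)
  sortDesc-powers xs-powers = All-resp-↭ (↭-sym (sortDesc-↭ _)) xs-powers

  ⊠-powers : ∀ {X ν} → All IsPower X → All IsPower ν → All IsPower (X ⊠ ν)
  ⊠-powers X-powers ν-powers =
    sortDesc-powers (concat⁺ (map⁺ᴬ (All.map (λ x-power → map⁺ᴬ (All.map (IsPower-* x-power) ν-powers)) X-powers)))

  -- Rounding to powers of p

  logFloorUpTo : ℕ → ℕ → ℕ
  logFloorUpTo n zero    = 0
  logFloorUpTo n (suc c) with p ^ suc c ≤? n
  ... | yes _ = suc c
  ... | no  _ = logFloorUpTo n c

  logFloor : ℕ → ℕ
  logFloor n = logFloorUpTo n n

  ^logFloorUpTo≤ : ∀ {n} c → 0 < n → p ^ logFloorUpTo n c ≤ n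
  ^logFloorUpTo≤ {n} zero    n>0 = n>0
  ^logFloorUpTo≤ {n} (suc c) n>0 with p ^ suc c ≤? n
  ... | yes pᶜ≤n = pᶜ≤n
  ... | no  _    = ^logFloorUpTo≤ c n>0

  ^≤⇒^≤^logFloorUpTo : ∀ {n d} c → d ≤ c → p ^ d ≤ n → p ^ d ≤ p ^ logFloorUpTo n c
  ^≤⇒^≤^logFloorUpTo     zero    z≤n _     = ≤-refl
  ^≤⇒^≤^logFloorUpTo {n} {d} (suc c) d≤c pᵈ≤n with p ^ suc c ≤? n
  ... | yes _     = ^-monoʳ-≤ p d≤c
  ... | no  pᶜ≰n with m≤n⇒m<n∨m≡n d≤c
  ...   | inj₁ d<c  = ^≤⇒^≤^logFloorUpTo c (≤-pred d<c) pᵈ≤n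
  ...   | inj₂ refl = contradiction pᵈ≤n pᶜ≰n

  ^logFloor≤ : ∀ {n} → 0 < n → p ^ logFloor n ≤ n
  ^logFloor≤ {n} = ^logFloorUpTo≤ n

  ^≤⇒^≤^logFloor : ∀ {n} d → p ^ d ≤ n → p ^ d ≤ p ^ logFloor n
  ^≤⇒^≤^logFloor {n} d pᵈ≤n with d ≤? n | 1 <? p
  ... | yes d≤n | _       = ^≤⇒^≤^logFloorUpTo n d≤n pᵈ≤n
  ... | no  d≰n | yes 1<p = contradiction (<-≤-trans (n<m^n 1<p d) pᵈ≤n) (<⇒≯ (≰⇒> d≰n))
  ... | no  _   | no  1≮p = subst (λ q → q ^ d ≤ q ^ logFloor n) (sym p≡1) (≤-reflexive (trans (^-zeroˡ d) (sym (^-zeroˡ (logFloor n)))))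
    where p≡1 = ≤-antisym (≮⇒≥ 1≮p) (>-nonZero⁻¹ p)

  ^≤*⇒^≤*^logFloor : ∀ j k {n} → p ^ k ≤ p ^ j * n → p ^ k ≤ p ^ j * p ^ logFloor n
  ^≤*⇒^≤*^logFloor j k {n} pᵏ≤pʲn with k ≤? j
  ... | yes k≤j = ≤-trans (^-monoʳ-≤ p k≤j) (m≤m*n (p ^ j) (p ^ logFloor n) ⦃ m^n≢0 p (logFloor n) ⦄)
  ... | no  k≰j = begin
    p ^ k                  ≡⟨ pᵏ≡pʲpᵏ⁻ʲ ⟩
    p ^ j * p ^ (k ∸ j)    ≤⟨ *-monoʳ-≤ (p ^ j) (^≤⇒^≤^logFloor (k ∸ j) pᵏ⁻ʲ≤n) ⟩
    p ^ j * p ^ logFloor n ∎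
    where
    open ≤-Reasoning
    pᵏ≡pʲpᵏ⁻ʲ : p ^ k ≡ p ^ j * p ^ (k ∸ j)
    pᵏ≡pʲpᵏ⁻ʲ = trans (cong (p ^_) (sym (m+[n∸m]≡n (<⇒≤ (≰⇒> k≰j))))) (^-distribˡ-+-* p j (k ∸ j))
    pᵏ⁻ʲ≤n : p ^ (k ∸ j) ≤ n
    pᵏ⁻ʲ≤n = *-cancelˡ-≤ (p ^ j) ⦃ m^n≢0 p j ⦄ (subst (_≤ p ^ j * n) pᵏ≡pʲpᵏ⁻ʲ pᵏ≤pʲn)

  -- p ^ j * n and p ^ j * p ^ logFloor n reach exactly the same thresholds p ^ k.
  *-above-logFloor : ∀ j k {n} → 0 < n →
                     n * above (p ^ k) (p ^ j * p ^ logFloor n) ≡ p ^ logFloor n * above (p ^ k) (p ^ j * n)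
  *-above-logFloor j k {n} n>0 with p ^ k ≤? p ^ j * p ^ logFloor n
  ... | yes reached = begin
    n * above (p ^ k) (p ^ j * p ^ logFloor n)     ≡⟨ cong (n *_) (above-≥ reached) ⟩
    n * (p ^ j * p ^ logFloor n)                   ≡⟨ *-rearrange n (p ^ j) (p ^ logFloor n) ⟩
    p ^ logFloor n * (p ^ j * n)                   ≡⟨ cong (p ^ logFloor n *_) (above-≥ reached′) ⟨
    p ^ logFloor n * above (p ^ k) (p ^ j * n)     ∎
    where
    open ≡-Reasoning
    reached′ = ≤-trans reached (*-monoʳ-≤ (p ^ j) (^logFloor≤ n>0))
    *-rearrange : ∀ a b c → a * (b * c) ≡ c * (b * a)
    *-rearrange = solve-∀
  ... | no  missed  = begin
    n * above (p ^ k) (p ^ j * p ^ logFloor n)     ≡⟨ cong (n *_) (above-< (≰⇒> missed)) ⟩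
    n * 0                                          ≡⟨ *-zeroʳ n ⟩
    0                                              ≡⟨ *-zeroʳ (p ^ logFloor n) ⟨
    p ^ logFloor n * 0                             ≡⟨ cong (p ^ logFloor n *_) (above-< (≰⇒> missed′)) ⟨
    p ^ logFloor n * above (p ^ k) (p ^ j * n)     ∎
    where
    open ≡-Reasoning
    missed′ = missed ∘ ^≤*⇒^≤*^logFloor j k

  powerBlock : ℕ → ℕ → List ℕ
  powerBlock M n = replicate (n * p ^ (M ∸ logFloor n)) (p ^ logFloor n)

  sum-powerBlock : ∀ j k {M n} → 0 < n → logFloor n ≤ M →
                   sum (map (λ y → above (p ^ k) (p ^ j * y)) (powerBlock M n)) ≡ p ^ M * above (p ^ k) (p ^ j * n)
  sum-powerBlock j k {M} {n} n>0 m≤M = begin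
    sum (map (λ y → above (p ^ k) (p ^ j * y)) (powerBlock M n)) ≡⟨ sum-map-replicate (λ y → above (p ^ k) (p ^ j * y)) (n * p ^ (M ∸ m)) (p ^ m) ⟩
    n * p ^ (M ∸ m) * A                                          ≡⟨ cong (_* A) (*-comm n (p ^ (M ∸ m))) ⟩
    p ^ (M ∸ m) * n * A                                          ≡⟨ *-assoc (p ^ (M ∸ m)) n A ⟩
    p ^ (M ∸ m) * (n * A)                                        ≡⟨ cong (p ^ (M ∸ m) *_) (*-above-logFloor j k n>0) ⟩
    p ^ (M ∸ m) * (p ^ m * B)                                    ≡⟨ *-assoc (p ^ (M ∸ m)) (p ^ m) B ⟨
    p ^ (M ∸ m) * p ^ m * B                                      ≡⟨ cong (_* B) (^-distribˡ-+-* p (M ∸ m) m) ⟨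
    p ^ (M ∸ m + m) * B                                          ≡⟨ cong (λ e → p ^ e * B) (m∸n+n≡m m≤M) ⟩
    p ^ M * B                                                    ∎
    where
    open ≡-Reasoning
    m = logFloor n
    A = above (p ^ k) (p ^ j * p ^ m)
    B = above (p ^ k) (p ^ j * n)

  exponentBound : List ℕ → ℕ
  exponentBound ν = sum (map logFloor ν)

  roundToPowers : List ℕ → List ℕ
  roundToPowers ν = sortDesc (concatMap (powerBlock (exponentBound ν)) ν)

  sumAbove-⊠-roundToPowers : ∀ {ν} → All (0 <_) ν → ∀ k {X} → All IsPower X →
    sumAbove (p ^ k) (X ⊠ roundToPowers ν) ≡ p ^ exponentBound ν * sumAbove (p ^ k) (X ⊠ ν)
  sumAbove-⊠-roundToPowers {ν} ν-positive k {X} X-powers = begin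
    sumAbove (p ^ k) (X ⊠ roundToPowers ν)               ≡⟨ sumAbove-⊠ (p ^ k) X (roundToPowers ν) ⟩
    sum (map (λ x → sum (map (g x) (roundToPowers ν))) X) ≡⟨ cong sum (map-cong-local (All.map scaled X-powers)) ⟩
    sum (map (λ x → c * sum (map (g x) ν)) X)            ≡⟨ sum-map-*ˡ c (λ x → sum (map (g x) ν)) X ⟩
    c * sum (map (λ x → sum (map (g x) ν)) X)            ≡⟨ cong (c *_) (sumAbove-⊠ (p ^ k) X ν) ⟨
    c * sumAbove (p ^ k) (X ⊠ ν)                         ∎
    where
    open ≡-Reasoning
    M = exponentBound ν
    c = p ^ M
    g = λ x y → above (p ^ k) (x * y)
    scaled : ∀ {x} → IsPower x → sum (map (g x) (roundToPowers ν)) ≡ c * sum (map (g x) ν)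
    scaled {x} (j , refl) = begin
      sum (map (g x) (roundToPowers ν))                           ≡⟨ sum-map-↭ (g x) (sortDesc-↭ _) ⟩
      sum (map (g x) (concatMap (powerBlock M) ν))                ≡⟨ sum-map-concatMap (g x) (powerBlock M) ν ⟩
      sum (map (λ n → sum (map (g x) (powerBlock M n))) ν)        ≡⟨ cong sum (map-cong-local blocks) ⟩
      sum (map (λ n → c * g x n) ν)                               ≡⟨ sum-map-*ˡ c (g x) ν ⟩
      c * sum (map (g x) ν)                                       ∎
      where
      blocks = All.map (λ (n>0 , m≤M) → sum-powerBlock j k n>0 m≤M) (All.zip (ν-positive , ≤-sum-map logFloor ν))

  IsPower⇒positive : ∀ {x} → IsPower x → 0 < x
  IsPower⇒positive (e , refl) = m^n>0 p e

  roundToPowers-powers : ∀ ν → All IsPower (roundToPowers ν)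
  roundToPowers-powers ν = sortDesc-powers (concat⁺ (map⁺ᴬ (All.universal block-powers ν)))
    where block-powers = λ n → replicate⁺ _ (logFloor n , refl)

  roundToPowers-nonempty : ∀ {ν} → All (0 <_) ν → 0 < length ν → 0 < length (roundToPowers ν)
  roundToPowers-nonempty {n ∷ ν} (n>0 ∷ _) _ = begin-strict
    0                                                <⟨ *-mono-≤ n>0 (m^n>0 p (M ∸ logFloor n)) ⟩
    n * p ^ (M ∸ logFloor n)                         ≡⟨ length-replicate _ ⟨
    length (powerBlock M n)                          ≤⟨ length-++-≤ˡ (powerBlock M n) ⟩
    length (concatMap (powerBlock M) (n ∷ ν))        ≡⟨ ↭-length (sortDesc-↭ _) ⟨
    length (roundToPowers (n ∷ ν))                   ∎
    where
    open ≤-Reasoning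
    M = exponentBound (n ∷ ν)

  roundedPartition : Partition → Partition
  roundedPartition ν = mkPartition (roundToPowers (entries ν))
                                   (All.map IsPower⇒positive (roundToPowers-powers (entries ν)))
                                   (sortDesc-nonincreasing _)

  -- Stable embeddings

  Dominated : List ℕ → List ℕ → List ℕ → Set
  Dominated ν X Y = ∀ k → sumAbove (p ^ k) (X ⊠ ν) ≤ sumAbove (p ^ k) (Y ⊠ ν)

  record StablyDominated (X Y : List ℕ) : Set where
    constructor stablyDominated
    field
      witness   : Partition
      nonempty  : 0 < length (entries witness)
      dominated : Dominated (entries witness) X Y

  dominated-roundToPowers : ∀ {ν X Y} → All (0 <_) ν → All IsPower X → All IsPower Y →
                            Dominated ν X Y → Dominated (roundToPowers ν) X Y
  dominated-roundToPowers {ν} ν-positive X-powers Y-powers X≼Y k =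
    subst₂ _≤_ (sym (sumAbove-⊠-roundToPowers ν-positive k X-powers))
               (sym (sumAbove-⊠-roundToPowers ν-positive k Y-powers))
               (*-monoʳ-≤ (p ^ exponentBound ν) (X≼Y k))

  stablyEmbeds⇔stablyDominated : ∀ lam mu → All IsPower (entries lam) → All IsPower (entries mu) →
                                 StablyEmbeds lam mu ⇔ StablyDominated (entries lam) (entries mu)
  stablyEmbeds⇔stablyDominated lam mu lam-powers mu-powers = mk⇔ necessary sufficient
    where
    necessary : StablyEmbeds lam mu → StablyDominated (entries lam) (entries mu)
    necessary (ν , ν≠[] , embeds) = stablyDominated ν ν≠[] λ k → ↪⇒sumAbove-≤ (entries lam ⊠ entries ν) (entries mu ⊠ entries ν) embeds (p ^ k)

    sufficient : StablyDominated (entries lam) (entries mu) → StablyEmbeds lam mu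
    sufficient (stablyDominated ν ν≠[] lam≼mu) =
      ν′ , roundToPowers-nonempty (positive ν) ν≠[] ,
      sumAbove-≤⇒↪ (Linked⇒AllPairs (flip ≤-trans) (sortDesc-nonincreasing _))
                   (⊠-powers lam-powers ν′-powers) (⊠-powers mu-powers ν′-powers)
                   (dominated-roundToPowers (positive ν) lam-powers mu-powers lam≼mu)
      where
      ν′ = roundedPartition ν
      ν′-powers = roundToPowers-powers (entries ν)

  stablyDominated-cancel : ∀ {X X′ Y Y′ Z} → X ↭ X′ ++ Z → Y ↭ Y′ ++ Z →
                           StablyDominated X Y ⇔ StablyDominated X′ Y′
  stablyDominated-cancel {Z = Z} X↭X′++Z Y↭Y′++Z = mk⇔
    (λ (stablyDominated ν ν≠[] X≼Y) → stablyDominated ν ν≠[] λ k →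
      +-cancelʳ-≤ (common ν k) _ _ (subst₂ _≤_ (split X↭X′++Z ν k) (split Y↭Y′++Z ν k) (X≼Y k)))
    (λ (stablyDominated ν ν≠[] X′≼Y′) → stablyDominated ν ν≠[] λ k →
      subst₂ _≤_ (sym (split X↭X′++Z ν k)) (sym (split Y↭Y′++Z ν k)) (+-monoˡ-≤ (common ν k) (X′≼Y′ k)))
    where
    common : Partition → ℕ → ℕ
    common ν k = sumAbove (p ^ k) (Z ⊠ entries ν)
    split : ∀ {W W′} → W ↭ W′ ++ Z → ∀ ν k → sumAbove (p ^ k) (W ⊠ entries ν) ≡ sumAbove (p ^ k) (W′ ⊠ entries ν) + common ν k
    split {W′ = W′} W↭W′++Z ν k = sumAbove-⊠-split (p ^ k) W′ Z (entries ν) W↭W′++Z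

  powEntries-powers : ∀ k a → All IsPower (powEntries p k a)
  powEntries-powers k []      = []
  powEntries-powers k (x ∷ a) = ++⁺ (replicate⁺ x (k , refl)) (powEntries-powers (suc k) a)

  powList-powers : ∀ a → All IsPower (powList p a)
  powList-powers a = sortDesc-powers (powEntries-powers 0 a)

corollary3p4 : (p : ℕ) → 0 < p → (a b : List ℕ) → (i : ℕ) →
    (lam mu lamt mut : Partition) →
    entries lam ≡ powList p a →
    entries mu ≡ powList p b →
    entries lamt ≡ powList p (modifyAt i (λ x → x ∸ (countAt a i ⊓ countAt b i)) a) →
    entries mut ≡ powList p (modifyAt i (λ x → x ∸ (countAt a i ⊓ countAt b i)) b) →
    StablyEmbeds lam mu ⇔ StablyEmbeds lamt mut
corollary3p4 p p>0 a b i lam mu lamt mut lam≡ mu≡ lamt≡ mut≡ = begin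
  StablyEmbeds lam mu                          ≈⟨ stablyEmbeds⇔stablyDominated lam mu (powers a lam≡) (powers b mu≡) ⟩
  StablyDominated (entries lam) (entries mu)   ≈⟨ stablyDominated-cancel (split a lam≡ lamt≡ (m⊓n≤m _ _))
                                                                         (split b mu≡ mut≡ (m⊓n≤n _ _)) ⟩
  StablyDominated (entries lamt) (entries mut) ≈⟨ stablyEmbeds⇔stablyDominated lamt mut (powers a′ lamt≡) (powers b′ mut≡) ⟨
  StablyEmbeds lamt mut                        ∎
  where
  open PowersOf p ⦃ >-nonZero p>0 ⦄
  open SetoidReasoning (⇔-setoid 0ℓ)
  c = countAt a i ⊓ countAt b i
  a′ = modifyAt i (_∸ c) a
  b′ = modifyAt i (_∸ c) b
  powers : ∀ d {X} → X ≡ powList p d → All IsPower X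
  powers d X≡ = subst (All IsPower) (sym X≡) (powList-powers d)
  split : ∀ d {X X′} → X ≡ powList p d → X′ ≡ powList p (modifyAt i (_∸ c) d) →
          c ≤ countAt d i → X ↭ X′ ++ replicate c (p ^ i)
  split d X≡ X′≡ c≤dᵢ =
    subst₂ (λ Y Y′ → Y ↭ Y′ ++ replicate c (p ^ i)) (sym X≡) (sym X′≡) (powList-split p i d c≤dᵢ)
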